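{- Let $G=(V,E)$ be a simple graph and $\varepsilon\in(0,1]$ a constant. For any fixed non-singleton $(2-\varepsilon)$-minimum cut $C(S)$ of $G$, the probability that a random $1$-out contraction preserves $C(S)$ is at least some constant $q_\varepsilon>0$ depending only on $\varepsilon$.
   Context: A random $1$-out contraction: every vertex independently selects a uniformly random incident edge, giving an edge set $I_1$, and the connected components of $(V,I_1)$ are contracted. It preserves a cut $C(S)$ (the set of edges with exactly one endpoint in $S$) iff $C(S)\cap I_1=\emptyset$. With $\lambda$ the edge connectivity of $G$, $C(S)$ is a $(2-\varepsilon)$-minimum cut if $|C(S)|\le(2-\varepsilon)\lambda$, and non-singleton if neither side has exactly one vertex.
   Formalization: The constant ε ranges over the rationals in (0,1]. -}

module Defs where

open import Data.Bool using (Bool; true; false; _∧_; _∨_; not; if_then_else_; _xor_)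
open import Data.Nat using (ℕ; zero; suc; _+_; _<ᵇ_; _≡ᵇ_; _⊓_)
open import Data.Fin using (Fin; toℕ)
open import Data.List using (List; []; _∷_; map; concatMap; foldr; allFin)
open import Data.Nat.ListAction using (sum)
open import Data.Bool.ListAction using (any; all)
open import Data.Vec using (Vec; []; _∷_; lookup)
open import Data.Fin.Subset using (Subset; _∈_)
open import Relation.Binary.PropositionalEquality using (_≡_)

record SimpleGraph (n : ℕ) : Set where
  field
    adj     : Fin n → Fin n → Bool
    sym     : ∀ u v → adj u v ≡ adj v u
    irrefl  : ∀ v → adj v v ≡ false
open SimpleGraph public

allVecs : {A : Set} → (k : ℕ) → List A → List (Vec A k)
allVecs zero    xs = [] ∷ []
allVecs (suc k) xs = concatMap (λ x → map (x ∷_) (allVecs k xs)) xs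

memb : ∀ {n} → Subset n → Fin n → Bool
memb S v = lookup S v

allSubsets : (n : ℕ) → List (Subset n)
allSubsets n = allVecs n (true ∷ false ∷ [])

countB : {A : Set} → (A → Bool) → List A → ℕ
countB p xs = sum (map (λ x → if p x then 1 else 0) xs)

cutSize : ∀ {n} → SimpleGraph n → Subset n → ℕ
cutSize {n} G S =
  sum (map (λ u → countB (λ v → (toℕ u <ᵇ toℕ v) ∧ adj G u v ∧ (memb S u xor memb S v)) (allFin n)) (allFin n))

size : ∀ {n} → Subset n → ℕ
size {n} S = countB (memb S) (allFin n)

properNonempty : ∀ {n} → Subset n → Bool
properNonempty {n} S = not (size S ≡ᵇ 0) ∧ not (size S ≡ᵇ n)

nonSingleton : ∀ {n} → Subset n → Bool
nonSingleton {n} S = not (size S ≡ᵇ 1) ∧ not (size {n} (Data.Vec.map not S) ≡ᵇ 1)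

minList : ℕ → List ℕ → ℕ
minList d []       = d
minList d (x ∷ xs) = foldr _⊓_ x xs

-- edge connectivity λ(G): minimum |C(S)| over nonempty proper S
-- (default 0 when n ≤ 1; irrelevant here since a non-singleton cut forces n ≥ 4)
edgeConnectivity : ∀ {n} → SimpleGraph n → ℕ
edgeConnectivity {n} G =
  minList 0 (concatMap (λ S → if properNonempty S then cutSize G S ∷ [] else []) (allSubsets n))

hasNeighbour : ∀ {n} → SimpleGraph n → Fin n → Bool
hasNeighbour {n} G v = any (adj G v) (allFin n)

-- A 1-out choice: c v is the other endpoint of the edge chosen by v.
-- Every vertex with at least one incident edge picks an incident edge;
-- an isolated vertex picks nothing (encoded as c v = v).
validChoice : ∀ {n} → SimpleGraph n → Vec (Fin n) n → Bool
validChoice {n} G c =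
  all (λ v → if hasNeighbour G v then adj G v (lookup c v)
             else (toℕ (lookup c v) ≡ᵇ toℕ v)) (allFin n)

preserves : ∀ {n} → Subset n → Vec (Fin n) n → Bool
preserves {n} S c = all (λ v → not (memb S v xor memb S (lookup c v))) (allFin n)

-- Size of the (uniform, product) sample space of 1-out choices
totalChoices : ∀ {n} → SimpleGraph n → ℕ
totalChoices {n} G = countB (validChoice G) (allVecs n (allFin n))

goodChoices : ∀ {n} → SimpleGraph n → Subset n → ℕ
goodChoices {n} G S = countB (λ c → validChoice G c ∧ preserves S c) (allVecs n (allFin n))

module Submission where

-- A 1-out choice picks, independently at each vertex v, one of its D(v) incident edges, and it
-- preserves C(S) iff no vertex picks one of its X(v) crossing edges; so good/total choices is
-- ∏ᵥ I(v)/D(v) with D = I + X. Moving a vertex w with X(w) > 0 across the cut yields a proper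
-- cut (this is where S non-singleton is used) of size |C(S)| − X(w) + I(w) ≥ λ. Together with
-- D(w) ≥ λ and |C(S)| ≤ (2 − 1/K)λ, where 1/K ≤ ε, this gives D(w) ≤ 2K·I(w), and Bernoulli's
-- inequality turns it into D(w)/I(w) ≤ (1 + 1/λ)^(2K·X(w)). As ∑ᵥ X(v) = 2|C(S)| ≤ 4λ, the
-- product of the ratios is at most (1 + 1/λ)^(8Kλ) ≤ 3^(16K).

module Sums where

  open import Defs using (countB; allVecs)
  open import Data.Bool using (Bool; true; false; _∧_; not; _xor_; if_then_else_)
  open import Data.Bool.ListAction using (all; and)
  open import Data.Fin using (Fin; zero; suc; _≟_)
  open import Data.List using (List; []; _∷_; map; allFin; concatMap; _++_)
  open import Data.List.Properties using (map-tabulate; map-++; map-∘)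
  open import Data.Nat using (ℕ; zero; suc; _+_; _*_)
  open import Data.Nat.ListAction using (sum; product)
  open import Data.Nat.ListAction.Properties using (sum-++)
  open import Data.Nat.Properties
    using (+-identityʳ; *-identityˡ; *-zeroʳ; *-distribˡ-+; *-distribʳ-+; +-commutativeSemigroup)
  open import Algebra.Properties.CommutativeSemigroup +-commutativeSemigroup using (interchange)
  open import Data.Vec using (_∷_; lookup)
  open import Function using (_∘_)
  open import Relation.Nullary using (does)
  open import Relation.Binary.PropositionalEquality

  bit : Bool → ℕ
  bit b = if b then 1 else 0

  bit-∧ : ∀ a b → bit (a ∧ b) ≡ bit a * bit b
  bit-∧ true  b = sym (*-identityˡ (bit b))
  bit-∧ false b = refl

  bit-split : ∀ a c → bit a ≡ bit (a ∧ not c) + bit (a ∧ c)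
  bit-split false c     = refl
  bit-split true  false = refl
  bit-split true  true  = refl

  xor-∧-bit : ∀ e x → bit (e xor x) + bit (e ∧ x) ≡ bit x + bit (e ∧ not x)
  xor-∧-bit false x     = refl
  xor-∧-bit true  true  = refl
  xor-∧-bit true  false = refl

  ∑ : {A : Set} → List A → (A → ℕ) → ℕ
  ∑ xs f = sum (map f xs)

  module _ {A : Set} where

    ∑-cong : ∀ {f g : A → ℕ} (xs : List A) → (∀ x → f x ≡ g x) → ∑ xs f ≡ ∑ xs g
    ∑-cong []       f≗g = refl
    ∑-cong (x ∷ xs) f≗g = cong₂ _+_ (f≗g x) (∑-cong xs f≗g)

    ∑-zero : ∀ (xs : List A) → ∑ xs (λ _ → 0) ≡ 0
    ∑-zero []       = refl
    ∑-zero (x ∷ xs) = ∑-zero xs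

    ∑-+ : ∀ (f g : A → ℕ) (xs : List A) → ∑ xs (λ x → f x + g x) ≡ ∑ xs f + ∑ xs g
    ∑-+ f g []       = refl
    ∑-+ f g (x ∷ xs) =
      trans (cong (f x + g x +_) (∑-+ f g xs)) (interchange (f x) (g x) (∑ xs f) (∑ xs g))

    ∑-*ˡ : ∀ c (f : A → ℕ) (xs : List A) → ∑ xs (λ x → c * f x) ≡ c * ∑ xs f
    ∑-*ˡ c f []       = sym (*-zeroʳ c)
    ∑-*ˡ c f (x ∷ xs) = trans (cong (c * f x +_) (∑-*ˡ c f xs)) (sym (*-distribˡ-+ c (f x) (∑ xs f)))

    ∑-*ʳ : ∀ c (f : A → ℕ) (xs : List A) → ∑ xs (λ x → f x * c) ≡ ∑ xs f * c
    ∑-*ʳ c f []       = refl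
    ∑-*ʳ c f (x ∷ xs) = trans (cong (f x * c +_) (∑-*ʳ c f xs)) (sym (*-distribʳ-+ c (f x) (∑ xs f)))

    countB-cong : ∀ {p q : A → Bool} (xs : List A) → (∀ x → p x ≡ q x) → countB p xs ≡ countB q xs
    countB-cong xs p≗q = ∑-cong xs (λ x → cong bit (p≗q x))

    countB-++ : ∀ (p : A → Bool) ys zs → countB p (ys ++ zs) ≡ countB p ys + countB p zs
    countB-++ p ys zs = trans (cong sum (map-++ (bit ∘ p) ys zs)) (sum-++ (map (bit ∘ p) ys) (map (bit ∘ p) zs))

    countB-concatMap : ∀ {B : Set} (p : A → Bool) (f : B → List A) xs →
                       countB p (concatMap f xs) ≡ ∑ xs (λ x → countB p (f x))
    countB-concatMap p f []       = refl
    countB-concatMap p f (x ∷ xs) =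
      trans (countB-++ p (f x) (concatMap f xs)) (cong (countB p (f x) +_) (countB-concatMap p f xs))

    countB-map : ∀ {B : Set} (p : A → Bool) (g : B → A) xs → countB p (map g xs) ≡ countB (p ∘ g) xs
    countB-map p g xs = cong sum (sym (map-∘ xs))

    countB-∧ : ∀ b (q : A → Bool) xs → countB (λ x → b ∧ q x) xs ≡ bit b * countB q xs
    countB-∧ b q xs = trans (∑-cong xs (λ x → bit-∧ b (q x))) (∑-*ˡ (bit b) (bit ∘ q) xs)

  ∑-comm : ∀ {A B : Set} (xs : List A) (ys : List B) (f : A → B → ℕ) →
           ∑ xs (λ x → ∑ ys (f x)) ≡ ∑ ys (λ y → ∑ xs (λ x → f x y))
  ∑-comm []       ys f = sym (∑-zero ys)
  ∑-comm (x ∷ xs) ys f =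
    trans (cong (∑ ys (f x) +_) (∑-comm xs ys f)) (sym (∑-+ (f x) (λ y → ∑ xs (λ x → f x y)) ys))

  map-allFin-suc : ∀ {A : Set} {k} (f : Fin (suc k) → A) →
                   map f (allFin (suc k)) ≡ f zero ∷ map (f ∘ suc) (allFin k)
  map-allFin-suc f = cong (f zero ∷_) (trans (map-tabulate suc f) (sym (map-tabulate (λ i → i) (f ∘ suc))))

  ∑-allFin-suc : ∀ {k} (f : Fin (suc k) → ℕ) → ∑ (allFin (suc k)) f ≡ f zero + ∑ (allFin k) (f ∘ suc)
  ∑-allFin-suc f = cong sum (map-allFin-suc f)

  ∑-allFin-const : ∀ k c → ∑ (allFin k) (λ _ → c) ≡ k * c
  ∑-allFin-const zero    c = refl
  ∑-allFin-const (suc k) c = trans (∑-allFin-suc {k} (λ _ → c)) (cong (c +_) (∑-allFin-const k c))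

  ∑-δ : ∀ {k} (w : Fin k) (g : Fin k → ℕ) → ∑ (allFin k) (λ u → bit (does (u ≟ w)) * g u) ≡ g w
  ∑-δ {suc k} zero g = begin
    ∑ (allFin (suc k)) (λ u → bit (does (u ≟ zero)) * g u) ≡⟨ ∑-allFin-suc {k} _ ⟩
    g zero + 0 + ∑ (allFin k) (λ _ → 0)                ≡⟨ cong (g zero + 0 +_) (∑-zero (allFin k)) ⟩
    g zero + 0 + 0                                      ≡⟨ trans (+-identityʳ _) (+-identityʳ (g zero)) ⟩
    g zero                                              ∎
    where open ≡-Reasoning
  ∑-δ {suc k} (suc w) g = trans (∑-allFin-suc {k} (λ u → bit (does (u ≟ suc w)) * g u)) (∑-δ w (g ∘ suc))

  countB-allVecs : ∀ {A : Set} k (xs : List A) (h : Fin k → A → Bool) →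
    countB (λ c → all (λ i → h i (lookup c i)) (allFin k)) (allVecs k xs)
    ≡ product (map (λ i → countB (h i) xs) (allFin k))
  countB-allVecs zero    xs h = refl
  countB-allVecs (suc k) xs h = begin
    countB ok (concatMap (λ x → map (x ∷_) (allVecs k xs)) xs)
      ≡⟨ countB-concatMap ok _ xs ⟩
    ∑ xs (λ x → countB ok (map (x ∷_) (allVecs k xs)))
      ≡⟨ ∑-cong xs (λ x → countB-map ok (x ∷_) (allVecs k xs)) ⟩
    ∑ xs (λ x → countB (λ c → ok (x ∷ c)) (allVecs k xs))
      ≡⟨ ∑-cong xs (λ x → countB-cong (allVecs k xs) (λ c → cong and (map-allFin-suc (λ i → h i (lookup (x ∷ c) i))))) ⟩
    ∑ xs (λ x → countB (λ c → h zero x ∧ ok′ c) (allVecs k xs))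
      ≡⟨ ∑-cong xs (λ x → countB-∧ (h zero x) ok′ (allVecs k xs)) ⟩
    ∑ xs (λ x → bit (h zero x) * countB ok′ (allVecs k xs))
      ≡⟨ ∑-*ʳ (countB ok′ (allVecs k xs)) (bit ∘ h zero) xs ⟩
    countB (h zero) xs * countB ok′ (allVecs k xs)
      ≡⟨ cong (countB (h zero) xs *_) (countB-allVecs k xs (h ∘ suc)) ⟩
    countB (h zero) xs * product (map (λ i → countB (h (suc i)) xs) (allFin k))
      ≡⟨ cong product (map-allFin-suc (λ i → countB (h i) xs)) ⟨
    product (map (λ i → countB (h i) xs) (allFin (suc k))) ∎
    where
    open ≡-Reasoning
    ok = λ c → all (λ i → h i (lookup c i)) (allFin (suc k))
    ok′ = λ c → all (λ i → h (suc i) (lookup c i)) (allFin k)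

  countB-δ : ∀ {k} (w : Fin k) (p : Fin k → Bool) → countB (λ u → does (u ≟ w) ∧ p u) (allFin k) ≡ bit (p w)
  countB-δ w p = trans (∑-cong (allFin _) (λ u → bit-∧ (does (u ≟ w)) (p u))) (∑-δ w (bit ∘ p))

  module _ {k : ℕ} where

    private
      F = allFin k

    ∑∑ : (Fin k → Fin k → ℕ) → ℕ
    ∑∑ f = ∑ F (λ u → ∑ F (f u))

    ∑∑-cong : ∀ {f g : Fin k → Fin k → ℕ} → (∀ u v → f u v ≡ g u v) → ∑∑ f ≡ ∑∑ g
    ∑∑-cong f≗g = ∑-cong F (λ u → ∑-cong F (f≗g u))

    ∑∑-+₃ : ∀ (f g h : Fin k → Fin k → ℕ) → ∑∑ (λ u v → f u v + g u v + h u v) ≡ ∑∑ f + ∑∑ g + ∑∑ h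
    ∑∑-+₃ f g h = begin
      ∑∑ (λ u v → f u v + g u v + h u v)
        ≡⟨ ∑-cong F (λ u → trans (∑-+ _ (h u) F) (cong (_+ ∑ F (h u)) (∑-+ (f u) (g u) F))) ⟩
      ∑ F (λ u → ∑ F (f u) + ∑ F (g u) + ∑ F (h u))
        ≡⟨ trans (∑-+ _ _ F) (cong (_+ ∑∑ h) (∑-+ _ _ F)) ⟩
      ∑∑ f + ∑∑ g + ∑∑ h ∎
      where open ≡-Reasoning

    ∑∑-row : ∀ w (f : Fin k → Fin k → Bool) →
             ∑∑ (λ u v → bit (does (u ≟ w) ∧ f u v)) ≡ countB (f w) F
    ∑∑-row w f = trans (∑-cong F (λ u → countB-∧ (does (u ≟ w)) (f u) F)) (∑-δ w (λ u → countB (f u) F))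

    ∑∑-col : ∀ w (f : Fin k → Fin k → Bool) →
             ∑∑ (λ u v → bit (does (v ≟ w) ∧ f u v)) ≡ countB (λ u → f u w) F
    ∑∑-col w f = ∑-cong F (λ u → countB-δ w (f u))

module Inequalities where

  open Sums using (∑)
  open import Data.List using (List; []; _∷_; map)
  open import Data.Nat
  open import Data.Nat.ListAction using (product)
  open import Data.Nat.Properties
  open import Data.Nat.Tactic.RingSolver using (solve-∀)
  open import Data.Product using (_×_; _,_; proj₁; proj₂)
  open import Relation.Binary.PropositionalEquality
  import Algebra.Properties.CommutativeSemigroup *-commutativeSemigroup as *-CS

  bernoulli : ∀ L m → L ^ m * (L + m) ≤ L * (L + 1) ^ m
  bernoulli L zero    = ≤-reflexive (base L)
    where
    base : ∀ L → 1 * (L + 0) ≡ L * 1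
    base = solve-∀
  bernoulli L (suc m) = begin
    L * L ^ m * (L + suc m)
      ≡⟨ expand L (L ^ m) m ⟩
    L * (L ^ m * (L + m)) + L * L ^ m
      ≤⟨ +-mono-≤ (*-monoʳ-≤ L (bernoulli L m)) (*-monoʳ-≤ L (^-monoˡ-≤ m (m≤m+n L 1))) ⟩
    L * (L * (L + 1) ^ m) + L * (L + 1) ^ m
      ≡⟨ collect L ((L + 1) ^ m) ⟩
    L * ((L + 1) * (L + 1) ^ m) ∎
    where
    open ≤-Reasoning
    expand : ∀ L P m → L * P * (L + suc m) ≡ L * (P * (L + m)) + L * P
    expand = solve-∀
    collect : ∀ L Q → L * (L * Q) + L * Q ≡ L * ((L + 1) * Q)
    collect = solve-∀

  bernoulli-upper : ∀ L k → 2 * k ≤ L + 2 → L * (L + 1) ^ k ≤ L ^ k * (L + 2 * k)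
  bernoulli-upper L zero    _  = ≤-reflexive (base L)
    where
    base : ∀ L → L * 1 ≡ 1 * (L + 2 * 0)
    base = solve-∀
  bernoulli-upper L (suc k) 2k+2≤L+2 = begin
    L * ((L + 1) * (L + 1) ^ k)
      ≡⟨ *-CS.x∙yz≈y∙xz L (L + 1) _ ⟩
    (L + 1) * (L * (L + 1) ^ k)
      ≤⟨ *-monoʳ-≤ (L + 1) (bernoulli-upper L k (≤-trans 2k≤L (m≤m+n L 2))) ⟩
    (L + 1) * (L ^ k * (L + 2 * k))
      ≡⟨ expand L (L ^ k) k ⟩
    L ^ k * L * (L + 2 * k) + L ^ k * L + L ^ k * (2 * k)
      ≤⟨ +-monoʳ-≤ (L ^ k * L * (L + 2 * k) + L ^ k * L) (*-monoʳ-≤ (L ^ k) 2k≤L) ⟩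
    L ^ k * L * (L + 2 * k) + L ^ k * L + L ^ k * L
      ≡⟨ collect L (L ^ k) k ⟩
    L * L ^ k * (L + 2 * suc k) ∎
    where
    open ≤-Reasoning
    2k≤L : 2 * k ≤ L
    2k≤L = +-cancelˡ-≤ 2 _ _ (subst₂ _≤_ (*-suc 2 k) (+-comm L 2) 2k+2≤L+2)
    expand : ∀ L P k → (L + 1) * (P * (L + 2 * k)) ≡ P * L * (L + 2 * k) + P * L + P * (2 * k)
    expand = solve-∀
    collect : ∀ L P k → P * L * (L + 2 * k) + P * L + P * L ≡ L * P * (L + 2 * suc k)
    collect = solve-∀

  [L+1]^k≤3*L^k : ∀ L .{{_ : NonZero L}} k → 2 * k ≤ L + 1 → (L + 1) ^ k ≤ 3 * L ^ k
  [L+1]^k≤3*L^k L k 2k≤L+1 = *-cancelˡ-≤ L (begin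
    L * (L + 1) ^ k    ≤⟨ bernoulli-upper L k (≤-trans 2k≤L+1 (+-monoʳ-≤ L (n≤1+n 1))) ⟩
    L ^ k * (L + 2 * k) ≤⟨ *-monoʳ-≤ (L ^ k) (+-monoʳ-≤ L 2k≤L+L) ⟩
    L ^ k * (L + (L + L)) ≡⟨ rearrange L (L ^ k) ⟩
    L * (3 * L ^ k)     ∎)
    where
    open ≤-Reasoning
    2k≤L+L : 2 * k ≤ L + L
    2k≤L+L = ≤-trans 2k≤L+1 (+-monoʳ-≤ L (>-nonZero⁻¹ L))
    rearrange : ∀ L P → P * (L + (L + L)) ≡ L * (3 * P)
    rearrange = solve-∀

  pow-≤-by-blocks : ∀ {a b c h} → (∀ k → k ≤ h → a ^ k ≤ c * b ^ k) →
                 ∀ J s → s ≤ J * h → a ^ s ≤ c ^ J * b ^ s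
  pow-≤-by-blocks block zero s s≤0 rewrite n≤0⇒n≡0 s≤0 = ≤-refl
  pow-≤-by-blocks {a} {b} {c} {h} block (suc J) s s≤h+Jh = begin
    a ^ s                       ≡⟨ cong (a ^_) split ⟨
    a ^ (h ⊓ s + (s ∸ h))       ≡⟨ ^-distribˡ-+-* a (h ⊓ s) (s ∸ h) ⟩
    a ^ (h ⊓ s) * a ^ (s ∸ h)
      ≤⟨ *-mono-≤ (block (h ⊓ s) (m⊓n≤m h s)) (pow-≤-by-blocks block J (s ∸ h) rest) ⟩
    c * b ^ (h ⊓ s) * (c ^ J * b ^ (s ∸ h)) ≡⟨ *-CS.interchange c (b ^ (h ⊓ s)) (c ^ J) (b ^ (s ∸ h)) ⟩
    c ^ suc J * (b ^ (h ⊓ s) * b ^ (s ∸ h)) ≡⟨ cong (c ^ suc J *_) (^-distribˡ-+-* b (h ⊓ s) (s ∸ h)) ⟨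
    c ^ suc J * b ^ (h ⊓ s + (s ∸ h)) ≡⟨ cong (λ t → c ^ suc J * b ^ t) split ⟩
    c ^ suc J * b ^ s           ∎
    where
    open ≤-Reasoning
    split : h ⊓ s + (s ∸ h) ≡ s
    split = m⊓n+n∸m≡n h s
    rest : s ∸ h ≤ J * h
    rest = ≤-trans (∸-monoˡ-≤ h s≤h+Jh) (≤-reflexive (m+n∸m≡n h (J * h)))

  ⌈n/2⌉-bounds : ∀ n → n ≤ 2 * ⌈ n /2⌉ × 2 * ⌈ n /2⌉ ≤ n + 1
  ⌈n/2⌉-bounds n = lower , upper
    where
    open ≤-Reasoning
    twice : 2 * ⌈ n /2⌉ ≡ ⌈ n /2⌉ + ⌈ n /2⌉
    twice = cong (⌈ n /2⌉ +_) (+-identityʳ ⌈ n /2⌉)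
    lower : n ≤ 2 * ⌈ n /2⌉
    lower = begin
      n                    ≡⟨ ⌊n/2⌋+⌈n/2⌉≡n n ⟨
      ⌊ n /2⌋ + ⌈ n /2⌉    ≤⟨ +-monoˡ-≤ ⌈ n /2⌉ (⌊n/2⌋≤⌈n/2⌉ n) ⟩
      ⌈ n /2⌉ + ⌈ n /2⌉    ≡⟨ twice ⟨
      2 * ⌈ n /2⌉          ∎
    upper : 2 * ⌈ n /2⌉ ≤ n + 1
    upper = begin
      2 * ⌈ n /2⌉          ≡⟨ twice ⟩
      ⌈ n /2⌉ + ⌈ n /2⌉    ≤⟨ +-monoˡ-≤ ⌈ n /2⌉ (⌊n/2⌋-mono (n≤1+n (suc n))) ⟩
      suc ⌊ n /2⌋ + ⌈ n /2⌉ ≡⟨ cong suc (⌊n/2⌋+⌈n/2⌉≡n n) ⟩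
      suc n                ≡⟨ +-comm 1 n ⟩
      n + 1                ∎

  -- s ≤ 16K⌈L/2⌉ splits into 16K blocks of at most ⌈L/2⌉ factors, each block costing a factor 3.
  [L+1]^s≤3^[16K]*L^s : ∀ K L s → s ≤ 8 * K * L → (L + 1) ^ s ≤ 3 ^ (16 * K) * L ^ s
  [L+1]^s≤3^[16K]*L^s K zero s s≤0 rewrite n≤0⇒n≡0 (≤-trans s≤0 (≤-reflexive (*-zeroʳ (8 * K)))) =
    ≤-trans (m^n>0 3 (16 * K)) (≤-reflexive (sym (*-identityʳ (3 ^ (16 * K)))))
  [L+1]^s≤3^[16K]*L^s K L@(suc _) s s≤8KL =
    pow-≤-by-blocks (λ k k≤h → [L+1]^k≤3*L^k L k (≤-trans (*-monoʳ-≤ 2 k≤h) 2h≤L+1)) (16 * K) s (begin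
      s                    ≤⟨ s≤8KL ⟩
      8 * K * L            ≤⟨ *-monoʳ-≤ (8 * K) L≤2h ⟩
      8 * K * (2 * h)      ≡⟨ regroup K h ⟩
      16 * K * h           ∎)
    where
    open ≤-Reasoning
    h = ⌈ L /2⌉
    L≤2h = proj₁ (⌈n/2⌉-bounds L)
    2h≤L+1 = proj₂ (⌈n/2⌉-bounds L)
    regroup : ∀ K h → 8 * K * (2 * h) ≡ 16 * K * h
    regroup = solve-∀

  ratio-bound : ∀ k L I X C → L ≤ I + X → L + X ≤ C + I → suc k * C + L ≤ 2 * suc k * L →
                  I + X ≤ 2 * suc k * I
  ratio-bound k L I X C L≤I+X L+X≤C+I KC+L≤2KL = begin
    I + X                 ≤⟨ +-monoʳ-≤ I X≤ ⟩
    I + (K * I + k * I)   ≡⟨ collect k I ⟩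
    2 * K * I             ∎
    where
    open ≤-Reasoning
    K = suc k
    KX+L≤KL+KI : K * X + L ≤ K * L + K * I
    KX+L≤KL+KI = +-cancelˡ-≤ (K * L) _ _ (begin
      K * L + (K * X + L)   ≡⟨ e₁ K L X ⟩
      K * (L + X) + L       ≤⟨ +-monoˡ-≤ L (*-monoʳ-≤ K L+X≤C+I) ⟩
      K * (C + I) + L       ≡⟨ e₂ K C I L ⟩
      (K * C + L) + K * I   ≤⟨ +-monoˡ-≤ (K * I) KC+L≤2KL ⟩
      2 * K * L + K * I     ≡⟨ e₃ K L I ⟩
      K * L + (K * L + K * I) ∎)
      where
      e₁ : ∀ K L X → K * L + (K * X + L) ≡ K * (L + X) + L
      e₁ = solve-∀
      e₂ : ∀ K C I L → K * (C + I) + L ≡ (K * C + L) + K * I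
      e₂ = solve-∀
      e₃ : ∀ K L I → 2 * K * L + K * I ≡ K * L + (K * L + K * I)
      e₃ = solve-∀
    X≤ : X ≤ K * I + k * I
    X≤ = +-cancelˡ-≤ (k * X + L) _ _ (begin
      k * X + L + X         ≡⟨ e₁ k X L ⟩
      suc k * X + L         ≤⟨ KX+L≤KL+KI ⟩
      suc k * L + K * I     ≡⟨ e₂ k L (K * I) ⟩
      k * L + L + K * I     ≤⟨ +-monoˡ-≤ (K * I) (+-monoˡ-≤ L (*-monoʳ-≤ k L≤I+X)) ⟩
      k * (I + X) + L + K * I ≡⟨ e₃ k I X L (K * I) ⟩
      k * X + L + (K * I + k * I) ∎)
      where
      e₁ : ∀ k X L → k * X + L + X ≡ suc k * X + L
      e₁ = solve-∀
      e₂ : ∀ k L M → suc k * L + M ≡ k * L + L + M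
      e₂ = solve-∀
      e₃ : ∀ k I X L M → k * (I + X) + L + M ≡ k * X + L + (M + k * I)
      e₃ = solve-∀
    collect : ∀ k I → I + (suc k * I + k * I) ≡ 2 * suc k * I
    collect = solve-∀

  pow-nonZero : ∀ c L s → s ≤ c * L → NonZero (L ^ s)
  pow-nonZero c (suc L) s _   = m^n≢0 (suc L) s
  pow-nonZero c zero    s s≤0 rewrite n≤0⇒n≡0 (≤-trans s≤0 (≤-reflexive (*-zeroʳ c))) = _

  bernoulli-ratio : ∀ L .{{_ : NonZero L}} m D I → L * D ≤ I * (L + m) → L ^ m * D ≤ I * (L + 1) ^ m
  bernoulli-ratio L m D I LD≤I[L+m] = *-cancelˡ-≤ L (begin
    L * (L ^ m * D)        ≡⟨ *-CS.x∙yz≈y∙xz L (L ^ m) D ⟩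
    L ^ m * (L * D)        ≤⟨ *-monoʳ-≤ (L ^ m) LD≤I[L+m] ⟩
    L ^ m * (I * (L + m))  ≡⟨ *-CS.x∙yz≈y∙xz (L ^ m) I (L + m) ⟩
    I * (L ^ m * (L + m))  ≤⟨ *-monoʳ-≤ I (bernoulli L m) ⟩
    I * (L * (L + 1) ^ m)  ≡⟨ *-CS.x∙yz≈y∙xz I L ((L + 1) ^ m) ⟩
    L * (I * (L + 1) ^ m)  ∎)
    where open ≤-Reasoning

  vertex-factor-bound : ∀ k L I X → (0 < X → L ≤ I + X × I + X ≤ 2 * suc k * I) →
                 L ^ (2 * suc k * X) * (I + X) ≤ I * (L + 1) ^ (2 * suc k * X)
  vertex-factor-bound k L       I zero    _ rewrite *-zeroʳ (2 * suc k) =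
    ≤-reflexive (trans (*-identityˡ (I + 0)) (trans (+-identityʳ I) (sym (*-identityʳ I))))
  vertex-factor-bound k zero    I (suc x) _ = z≤n
  vertex-factor-bound k L@(suc _) I X@(suc _) bounds with bounds z<s
  ... | L≤I+X , I+X≤2KI = bernoulli-ratio L (2 * suc k * X) (I + X) I (begin
    L * (I + X)            ≡⟨ *-distribˡ-+ L I X ⟩
    L * I + L * X          ≤⟨ +-monoʳ-≤ (L * I) (*-monoˡ-≤ X (≤-trans L≤I+X I+X≤2KI)) ⟩
    L * I + 2 * suc k * I * X ≡⟨ regroup L I (suc k) X ⟩
    I * (L + 2 * suc k * X) ∎)
    where
    open ≤-Reasoning
    regroup : ∀ L I K X → L * I + 2 * K * I * X ≡ I * (L + 2 * K * X)
    regroup = solve-∀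

  ∏-pow-bound : ∀ {A : Set} (xs : List A) a b (m D I : A → ℕ) → (∀ x → a ^ m x * D x ≤ I x * b ^ m x) →
                a ^ ∑ xs m * product (map D xs) ≤ product (map I xs) * b ^ ∑ xs m
  ∏-pow-bound []       a b m D I bound = ≤-refl
  ∏-pow-bound (x ∷ xs) a b m D I bound = begin
    a ^ (m x + ∑ xs m) * (D x * ∏D)       ≡⟨ cong (_* (D x * ∏D)) (^-distribˡ-+-* a (m x) (∑ xs m)) ⟩
    a ^ m x * a ^ ∑ xs m * (D x * ∏D)     ≡⟨ *-CS.interchange (a ^ m x) (a ^ ∑ xs m) (D x) ∏D ⟩
    a ^ m x * D x * (a ^ ∑ xs m * ∏D)     ≤⟨ *-mono-≤ (bound x) (∏-pow-bound xs a b m D I bound) ⟩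
    I x * b ^ m x * (∏I * b ^ ∑ xs m)     ≡⟨ *-CS.interchange (I x) (b ^ m x) ∏I (b ^ ∑ xs m) ⟩
    I x * ∏I * (b ^ m x * b ^ ∑ xs m)     ≡⟨ cong (I x * ∏I *_) (^-distribˡ-+-* b (m x) (∑ xs m)) ⟨
    I x * ∏I * b ^ (m x + ∑ xs m)         ∎
    where
    open ≤-Reasoning
    ∏D = product (map D xs)
    ∏I = product (map I xs)

module Subsets where

  open Sums
  open import Defs using (countB; memb; size; properNonempty; nonSingleton)
  open import Data.Bool using (Bool; true; false; _∧_; not; _xor_)
  open import Data.Bool.Properties using (not-distribʳ-xor)
  open import Data.Fin using (Fin; _≟_)
  open import Data.Fin.Subset using (Subset; ∁; ⊥)
  open import Data.List using (allFin)
  open import Data.Nat using (ℕ; _+_; _*_; _≡ᵇ_)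
  import Data.Nat as ℕ
  open import Data.Nat.Properties using (+-identityʳ; *-identityʳ; +-comm; +-cancelˡ-≡; 1+n≢0)
  open import Data.Product using (_×_; _,_)
  open import Data.Vec using (lookup; updateAt)
  open import Data.Vec.Properties using (lookup∘updateAt; lookup∘updateAt′; lookup-map; lookup-replicate)
  open import Function using (_∘_)
  open import Relation.Binary.PropositionalEquality
  open import Relation.Nullary using (does; yes; no)
  open import Relation.Nullary.Decidable using (dec-true; dec-false)

  crosses : ∀ {n} → Subset n → Fin n → Fin n → Bool
  crosses S u v = memb S u xor memb S v

  toggle : ∀ {n} → Subset n → Fin n → Subset n
  toggle S w = updateAt S w not

  memb-toggle : ∀ {n} (S : Subset n) w u → memb (toggle S w) u ≡ does (u ≟ w) xor memb S u
  memb-toggle S w u with u ≟ w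
  ... | yes refl = lookup∘updateAt u S
  ... | no u≢w   = lookup∘updateAt′ u w u≢w S

  size-toggle : ∀ {n} (S : Subset n) w → size (toggle S w) + bit (memb S w) ≡ size S + bit (not (memb S w))
  size-toggle {n} S w = begin
    size (toggle S w) + bit (memb S w)
      ≡⟨ cong (size (toggle S w) +_) (countB-δ w (memb S)) ⟨
    size (toggle S w) + countB (λ u → does (u ≟ w) ∧ memb S u) V
      ≡⟨ ∑-+ (bit ∘ memb (toggle S w)) (λ u → bit (does (u ≟ w) ∧ memb S u)) V ⟨
    ∑ V (λ u → bit (memb (toggle S w) u) + bit (does (u ≟ w) ∧ memb S u))
      ≡⟨ ∑-cong V pointwise ⟩
    ∑ V (λ u → bit (memb S u) + bit (does (u ≟ w) ∧ not (memb S u)))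
      ≡⟨ ∑-+ (bit ∘ memb S) (λ u → bit (does (u ≟ w) ∧ not (memb S u))) V ⟩
    size S + countB (λ u → does (u ≟ w) ∧ not (memb S u)) V
      ≡⟨ cong (size S +_) (countB-δ w (not ∘ memb S)) ⟩
    size S + bit (not (memb S w)) ∎
    where
    open ≡-Reasoning
    V = allFin n
    pointwise : ∀ u → bit (memb (toggle S w) u) + bit (does (u ≟ w) ∧ memb S u)
                    ≡ bit (memb S u) + bit (does (u ≟ w) ∧ not (memb S u))
    pointwise u = trans (cong (λ b → bit b + bit (does (u ≟ w) ∧ memb S u)) (memb-toggle S w u))
                        (xor-∧-bit (does (u ≟ w)) (memb S u))

  size-toggle≢0 : ∀ {n} (S : Subset n) w → size S ≢ 1 → size (toggle S w) ≢ 0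
  size-toggle≢0 S w size≢1 size′≡0 with memb S w | size-toggle S w
  ... | true  | eq = size≢1 (trans (sym (+-identityʳ (size S))) (trans (sym eq) (cong (_+ 1) size′≡0)))
  ... | false | eq = 1+n≢0 (trans (+-comm 1 (size S)) (trans (sym eq) (cong (_+ 0) size′≡0)))

  size+size∁ : ∀ {n} (S : Subset n) → size S + size (∁ S) ≡ n
  size+size∁ {n} S = begin
    size S + size (∁ S)                              ≡⟨ ∑-+ (bit ∘ memb S) (bit ∘ memb (∁ S)) V ⟨
    ∑ V (λ u → bit (memb S u) + bit (memb (∁ S) u))  ≡⟨ ∑-cong V complementary ⟩
    ∑ V (λ _ → 1)                                    ≡⟨ ∑-allFin-const n 1 ⟩
    n * 1                                            ≡⟨ *-identityʳ n ⟩
    n                                                ∎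
    where
    open ≡-Reasoning
    V = allFin n
    bit+bit-not : ∀ b → bit b + bit (not b) ≡ 1
    bit+bit-not true  = refl
    bit+bit-not false = refl
    complementary : ∀ u → bit (memb S u) + bit (memb (∁ S) u) ≡ 1
    complementary u = trans (cong (λ b → bit (memb S u) + bit b) (lookup-map u not S)) (bit+bit-not (memb S u))

  size≡n⇒size∁≡0 : ∀ {n} (S : Subset n) → size S ≡ n → size (∁ S) ≡ 0
  size≡n⇒size∁≡0 {n} S size≡n =
    +-cancelˡ-≡ n _ 0 (trans (cong (_+ size (∁ S)) (sym size≡n)) (trans (size+size∁ S) (sym (+-identityʳ n))))

  size∁-toggle : ∀ {n} (S : Subset n) w → size (∁ (toggle S w)) ≡ size (toggle (∁ S) w)
  size∁-toggle {n} S w = countB-cong (allFin n) (λ u → begin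
    lookup (∁ (toggle S w)) u        ≡⟨ lookup-map u not (toggle S w) ⟩
    not (memb (toggle S w) u)         ≡⟨ cong not (memb-toggle S w u) ⟩
    not (does (u ≟ w) xor memb S u)   ≡⟨ not-distribʳ-xor (does (u ≟ w)) (memb S u) ⟩
    does (u ≟ w) xor not (memb S u)   ≡⟨ cong (does (u ≟ w) xor_) (lookup-map u not S) ⟨
    does (u ≟ w) xor memb (∁ S) u     ≡⟨ memb-toggle (∁ S) w u ⟨
    memb (toggle (∁ S) w) u           ∎)
    where open ≡-Reasoning

  -- does (m ℕ.≟ k) computes to m ≡ᵇ k, so dec-true and dec-false apply to the Boolean tests of Defs.
  ≡ᵇ-false⇒≢ : ∀ {m k} → (m ≡ᵇ k) ≡ false → m ≢ k
  ≡ᵇ-false⇒≢ {m} {k} m≢ᵇk m≡k with () ← trans (sym (dec-true (m ℕ.≟ k) m≡k)) m≢ᵇk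

  nonSingleton⇒≢1 : ∀ {n} (S : Subset n) → nonSingleton S ≡ true → size S ≢ 1 × size (∁ S) ≢ 1
  nonSingleton⇒≢1 S ns with size S ≡ᵇ 1 in e₁ | size (∁ S) ≡ᵇ 1 in e₂
  nonSingleton⇒≢1 S refl | false | false = ≡ᵇ-false⇒≢ e₁ , ≡ᵇ-false⇒≢ e₂

  properNonempty-toggle : ∀ {n} (S : Subset n) w → size S ≢ 1 → size (∁ S) ≢ 1 →
                          properNonempty (toggle S w) ≡ true
  properNonempty-toggle {n} S w size≢1 size∁≢1 =
    cong₂ (λ a b → not a ∧ not b) (dec-false (size (toggle S w) ℕ.≟ 0) (size-toggle≢0 S w size≢1))
                                  (dec-false (size (toggle S w) ℕ.≟ n) size′≢n)
    where
    size′≢n : size (toggle S w) ≢ n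
    size′≢n size′≡n = size-toggle≢0 (∁ S) w size∁≢1
      (trans (sym (size∁-toggle S w)) (size≡n⇒size∁≡0 (toggle S w) size′≡n))

  size-⊥ : ∀ {n} → size {n} ⊥ ≡ 0
  size-⊥ {n} = trans (∑-cong (allFin n) (λ u → cong bit (lookup-replicate u false))) (∑-zero (allFin n))

module Cuts where

  open Sums
  open Inequalities
  open Subsets
  open import Defs hiding (sym)
  open import Data.Bool using (Bool; true; false; _∧_; not; if_then_else_; _xor_; T)
  open import Data.Bool.ListAction using (all; any)
  open import Data.Bool.Properties
    using (∧-zeroʳ; ∧-identityʳ; ∨-conicalˡ; ∨-conicalʳ; xor-same; xor-comm; not-distribˡ-xor; not-distribʳ-xor)
  open import Data.Fin using (Fin; zero; suc; _≟_; toℕ)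
  open import Data.Fin.Properties using (toℕ-injective)
  open import Data.Fin.Subset using (Subset; ∁; ⊥)
  open import Data.List using (List; []; _∷_; map; allFin; foldr)
  open import Data.List.Membership.Propositional using (_∈_)
  open import Data.List.Membership.Propositional.Properties using (∈-map⁺; ∈-concatMap⁺; ∈-allFin)
  open import Data.List.Relation.Unary.Any using (here; there)
  import Data.List.Relation.Unary.Any as Any
  open import Data.Nat hiding (_≟_)
  import Data.Nat as ℕ
  open import Data.Nat.ListAction using (product)
  open import Data.Nat.Properties hiding (_≟_)
  open import Data.Nat.Tactic.RingSolver using (solve-∀)
  open import Data.Product using (_×_; _,_; uncurry)
  open import Data.Unit using (tt)
  open import Data.Vec using (Vec; []; _∷_; lookup)
  open import Data.Vec.Properties using (lookup-replicate)
  open import Function using (_∘_)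
  open import Relation.Binary.PropositionalEquality
  open import Relation.Nullary using (does; yes; no; contradiction)
  open import Relation.Nullary.Reflects using (ofʸ; ofⁿ)
  import Algebra.Properties.CommutativeSemigroup *-commutativeSemigroup as *-CS

  module _ {A : Set} where

    all-∧ : ∀ (p q : A → Bool) xs → all (λ x → p x ∧ q x) xs ≡ all p xs ∧ all q xs
    all-∧ p q []       = refl
    all-∧ p q (x ∷ xs) with p x | q x
    ... | false | _     = refl
    ... | true  | true  = all-∧ p q xs
    ... | true  | false = sym (∧-zeroʳ (all p xs))

    any-false : ∀ (p : A → Bool) {xs x} → any p xs ≡ false → x ∈ xs → p x ≡ false
    any-false p {y ∷ ys} none (here refl) = ∨-conicalˡ (p y) (any p ys) none
    any-false p {y ∷ ys} none (there x∈)  = any-false p (∨-conicalʳ (p y) (any p ys) none) x∈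

  foldr-⊓-≤ : ∀ x xs {y} → y ∈ x ∷ xs → foldr _⊓_ x xs ≤ y
  foldr-⊓-≤ x []       (here refl)         = ≤-refl
  foldr-⊓-≤ x (z ∷ zs) (here refl)         = ≤-trans (m⊓n≤n z _) (foldr-⊓-≤ x zs (here refl))
  foldr-⊓-≤ x (z ∷ zs) (there (here refl)) = m⊓n≤m z _
  foldr-⊓-≤ x (z ∷ zs) (there (there y∈)) = ≤-trans (m⊓n≤n z _) (foldr-⊓-≤ x zs (there y∈))

  minList-≤ : ∀ d xs {y} → y ∈ xs → minList d xs ≤ y
  minList-≤ d (x ∷ xs) = foldr-⊓-≤ x xs

  ∈-allVecs : ∀ {A : Set} k (xs : List A) (v : Vec A k) → (∀ i → lookup v i ∈ xs) → v ∈ allVecs k xs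
  ∈-allVecs zero    xs []      _       = here refl
  ∈-allVecs (suc k) xs (a ∷ v) entries =
    ∈-concatMap⁺ (λ x → map (x ∷_) (allVecs k xs))
      (Any.map (λ { refl → ∈-map⁺ (a ∷_) (∈-allVecs k xs v (entries ∘ suc)) }) (entries zero))

  ∈-allSubsets : ∀ {n} (T : Subset n) → T ∈ allSubsets n
  ∈-allSubsets {n} T = ∈-allVecs n _ T (λ i → ∈-bools (lookup T i))
    where
    ∈-bools : ∀ b → b ∈ true ∷ false ∷ []
    ∈-bools true  = here refl
    ∈-bools false = there (here refl)

  edgeConnectivity≤cutSize : ∀ {n} (G : SimpleGraph n) T → properNonempty T ≡ true →
                             edgeConnectivity G ≤ cutSize G T
  edgeConnectivity≤cutSize {n} G T proper =
    minList-≤ 0 _ (∈-concatMap⁺ candidates (Any.map (λ { refl → T-candidate }) (∈-allSubsets T)))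
    where
    candidates : Subset n → List ℕ
    candidates S = if properNonempty S then cutSize G S ∷ [] else []
    T-candidate : cutSize G T ∈ candidates T
    T-candidate rewrite proper = here refl

  -- Contribution of the ordered pair (u, v) to 2|C(S △ {w})| + 2X(w) and to 2|C(S)| + 2N(w):
  -- eᵢ says whether the i-th endpoint is w, a whether u and v are adjacent, x and y whether they lie in S.
  toggle-pair : ∀ a x y e₁ e₂ → (e₁ ≡ true → e₂ ≡ true → a ≡ false) →
    bit (a ∧ ((e₁ xor x) xor (e₂ xor y))) + bit (e₁ ∧ a ∧ (x xor y)) + bit (e₂ ∧ a ∧ (x xor y))
    ≡ bit (a ∧ (x xor y)) + bit (e₁ ∧ a ∧ not (x xor y)) + bit (e₂ ∧ a ∧ not (x xor y))
  toggle-pair a x y false false _ = refl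
  toggle-pair a x y true  true  loop rewrite loop refl refl = refl
  toggle-pair a x y true  false _ rewrite sym (not-distribˡ-xor x y) =
    cong (_+ 0) (+-comm (bit (a ∧ not (x xor y))) (bit (a ∧ (x xor y))))
  toggle-pair a x y false true  _ rewrite sym (not-distribʳ-xor x y) =
    swap-around-0 (bit (a ∧ not (x xor y))) (bit (a ∧ (x xor y)))
    where
    swap-around-0 : ∀ p q → p + 0 + q ≡ q + 0 + p
    swap-around-0 p q rewrite +-identityʳ p | +-identityʳ q = +-comm p q

  module _ {n : ℕ} (G : SimpleGraph n) where

    private
      V = allFin n

    crossing internal : Subset n → Fin n → Fin n → Bool
    crossing S u v = adj G u v ∧ crosses S u v
    internal S u v = adj G u v ∧ not (crosses S u v)

    degree : Fin n → ℕ
    degree v = countB (adj G v) V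

    cutDegree innerDegree : Subset n → Fin n → ℕ
    cutDegree   S v = countB (crossing S v) V
    innerDegree S v = countB (internal S v) V

    crossing-sym : ∀ S u v → crossing S u v ≡ crossing S v u
    crossing-sym S u v = cong₂ _∧_ (SimpleGraph.sym G u v) (xor-comm (memb S u) (memb S v))

    internal-sym : ∀ S u v → internal S u v ≡ internal S v u
    internal-sym S u v = cong₂ (λ a b → a ∧ not b) (SimpleGraph.sym G u v) (xor-comm (memb S u) (memb S v))

    crossing-split : ∀ S u v →
      bit (crossing S u v)
      ≡ bit ((toℕ u <ᵇ toℕ v) ∧ crossing S u v) + bit ((toℕ v <ᵇ toℕ u) ∧ crossing S v u)
    crossing-split S u v
      with toℕ u <ᵇ toℕ v | <ᵇ-reflects-< (toℕ u) (toℕ v) | toℕ v <ᵇ toℕ u | <ᵇ-reflects-< (toℕ v) (toℕ u)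
    ... | true  | ofʸ u<v | true  | ofʸ v<u = contradiction v<u (<-asym u<v)
    ... | true  | _       | false | _       = sym (+-identityʳ _)
    ... | false | _       | true  | _       = cong bit (crossing-sym S u v)
    ... | false | ofⁿ u≮v | false | ofⁿ v≮u with toℕ-injective (≤-antisym (≮⇒≥ v≮u) (≮⇒≥ u≮v))
    ...   | refl rewrite SimpleGraph.irrefl G u = refl

    ∑-cutDegree : ∀ S → ∑ V (cutDegree S) ≡ 2 * cutSize G S
    ∑-cutDegree S = begin
      ∑ V (λ u → ∑ V (λ v → bit (crossing S u v)))
        ≡⟨ ∑-cong V (λ u → trans (∑-cong V (crossing-split S u)) (∑-+ (bit ∘ lt u) (λ v → bit (lt v u)) V)) ⟩
      ∑ V (λ u → ∑ V (λ v → bit (lt u v)) + ∑ V (λ v → bit (lt v u)))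
        ≡⟨ ∑-+ _ _ V ⟩
      cutSize G S + ∑ V (λ u → ∑ V (λ v → bit (lt v u)))
        ≡⟨ cong (cutSize G S +_) (∑-comm V V (λ u v → bit (lt v u))) ⟩
      cutSize G S + cutSize G S
        ≡⟨ cong (cutSize G S +_) (+-identityʳ (cutSize G S)) ⟨
      2 * cutSize G S ∎
      where
      open ≡-Reasoning
      lt : Fin n → Fin n → Bool
      lt u v = (toℕ u <ᵇ toℕ v) ∧ crossing S u v

    -- Proved for the doubled sizes, which are sums over ordered pairs.
    cutSize-toggle : ∀ S w → cutSize G (toggle S w) + cutDegree S w ≡ cutSize G S + innerDegree S w
    cutSize-toggle S w = *-cancelˡ-≡ _ _ 2 (begin
      2 * (cutSize G S′ + X)
        ≡⟨ double (cutSize G S′) X ⟩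
      2 * cutSize G S′ + X + X
        ≡⟨ cong₂ _+_ (cong₂ _+_ (∑-cutDegree S′) (∑∑-row w (crossing S)))
                     (trans (∑∑-col w (crossing S)) (countB-cong V (λ u → crossing-sym S u w))) ⟨
      ∑∑ (λ u v → bit (crossing S′ u v)) + ∑∑ (row (crossing S)) + ∑∑ (col (crossing S))
        ≡⟨ ∑∑-+₃ (λ u v → bit (crossing S′ u v)) (row (crossing S)) (col (crossing S)) ⟨
      ∑∑ (λ u v → bit (crossing S′ u v) + row (crossing S) u v + col (crossing S) u v)
        ≡⟨ ∑∑-cong pair ⟩
      ∑∑ (λ u v → bit (crossing S u v) + row (internal S) u v + col (internal S) u v)
        ≡⟨ ∑∑-+₃ (λ u v → bit (crossing S u v)) (row (internal S)) (col (internal S)) ⟩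
      ∑∑ (λ u v → bit (crossing S u v)) + ∑∑ (row (internal S)) + ∑∑ (col (internal S))
        ≡⟨ cong₂ _+_ (cong₂ _+_ (∑-cutDegree S) (∑∑-row w (internal S)))
                     (trans (∑∑-col w (internal S)) (countB-cong V (λ u → internal-sym S u w))) ⟩
      2 * cutSize G S + N + N
        ≡⟨ double (cutSize G S) N ⟨
      2 * (cutSize G S + N) ∎)
      where
      open ≡-Reasoning
      S′ = toggle S w
      X = cutDegree S w
      N = innerDegree S w
      row col : (Fin n → Fin n → Bool) → Fin n → Fin n → ℕ
      row f u v = bit (does (u ≟ w) ∧ f u v)
      col f u v = bit (does (v ≟ w) ∧ f u v)
      double : ∀ a b → 2 * (a + b) ≡ 2 * a + b + b
      double = solve-∀
      pair : ∀ u v → bit (crossing S′ u v) + row (crossing S) u v + col (crossing S) u v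
                   ≡ bit (crossing S u v) + row (internal S) u v + col (internal S) u v
      pair u v rewrite memb-toggle S w u | memb-toggle S w v =
        toggle-pair (adj G u v) (memb S u) (memb S v) (does (u ≟ w)) (does (v ≟ w)) loop
        where
        loop : does (u ≟ w) ≡ true → does (v ≟ w) ≡ true → adj G u v ≡ false
        loop _ _ with u ≟ w | v ≟ w
        ... | yes refl | yes refl = SimpleGraph.irrefl G u

    crosses-⊥ : ∀ u v → crosses ⊥ u v ≡ false
    crosses-⊥ u v rewrite lookup-replicate {n = n} u false | lookup-replicate {n = n} v false = refl

    cutDegree-⊥ : ∀ w → cutDegree ⊥ w ≡ 0
    cutDegree-⊥ w =
      trans (countB-cong V (λ v → trans (cong (adj G w v ∧_) (crosses-⊥ w v)) (∧-zeroʳ _))) (∑-zero V)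

    innerDegree-⊥ : ∀ w → innerDegree ⊥ w ≡ degree w
    innerDegree-⊥ w =
      countB-cong V (λ v → trans (cong (λ b → adj G w v ∧ not b) (crosses-⊥ w v)) (∧-identityʳ _))

    cutSize-⊥ : cutSize G ⊥ ≡ 0
    cutSize-⊥ = *-cancelˡ-≡ _ 0 2 (trans (sym (∑-cutDegree ⊥)) (trans (∑-cong V cutDegree-⊥) (∑-zero V)))

    -- With a single vertex there are no cuts and λ is the default 0.
    edgeConnectivity≤degree : ∀ w → edgeConnectivity G ≤ degree w
    edgeConnectivity≤degree w with n ℕ.≟ 1
    ... | yes refl = z≤n
    ... | no n≢1 = begin
      edgeConnectivity G
        ≤⟨ edgeConnectivity≤cutSize G (toggle ⊥ w) (properNonempty-toggle ⊥ w size≢1 size∁≢1) ⟩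
      cutSize G (toggle ⊥ w)                     ≡⟨ +-identityʳ _ ⟨
      cutSize G (toggle ⊥ w) + 0                 ≡⟨ cong (cutSize G (toggle ⊥ w) +_) (cutDegree-⊥ w) ⟨
      cutSize G (toggle ⊥ w) + cutDegree ⊥ w     ≡⟨ cutSize-toggle ⊥ w ⟩
      cutSize G ⊥ + innerDegree ⊥ w              ≡⟨ cong₂ _+_ cutSize-⊥ (innerDegree-⊥ w) ⟩
      degree w                                   ∎
      where
      open ≤-Reasoning
      size≢1 : size {n} ⊥ ≢ 1
      size≢1 eq = 0≢1+n (trans (sym (size-⊥ {n})) eq)
      size∁≢1 : size (∁ {n} ⊥) ≢ 1
      size∁≢1 eq = n≢1 (trans (sym (size+size∁ ⊥)) (trans (cong₂ _+_ (size-⊥ {n}) eq) refl))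

    choosable : Fin n → Fin n → Bool
    choosable v y = if hasNeighbour G v then adj G v y else (toℕ y ≡ᵇ toℕ v)

    options : Fin n → ℕ
    options v = countB (choosable v) V

    safeOptions : Subset n → Fin n → ℕ
    safeOptions S v = countB (λ y → choosable v y ∧ not (crosses S v y)) V

    totalChoices≡∏options : totalChoices G ≡ product (map options V)
    totalChoices≡∏options = countB-allVecs n V choosable

    goodChoices≡∏safeOptions : ∀ S → goodChoices G S ≡ product (map (safeOptions S) V)
    goodChoices≡∏safeOptions S = trans
      (countB-cong (allVecs n V) (λ c → sym (all-∧ (λ v → choosable v (lookup c v))
                                                   (λ v → not (crosses S v (lookup c v))) V)))
      (countB-allVecs n V (λ v y → choosable v y ∧ not (crosses S v y)))

    adj-isolated : ∀ {v} → hasNeighbour G v ≡ false → ∀ y → adj G v y ≡ false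
    adj-isolated {v} isolated y = any-false (adj G v) isolated (∈-allFin y)

    choosable-crosses : ∀ S v y → choosable v y ∧ crosses S v y ≡ crossing S v y
    choosable-crosses S v y with hasNeighbour G v in nb
    ... | true  = refl
    ... | false rewrite adj-isolated nb y with toℕ y ≡ᵇ toℕ v in y≡ᵇv
    ...   | false = refl
    ...   | true rewrite toℕ-injective (≡ᵇ⇒≡ (toℕ y) (toℕ v) (subst T (sym y≡ᵇv) tt)) = xor-same (memb S v)

    options≡safeOptions+cutDegree : ∀ S v → options v ≡ safeOptions S v + cutDegree S v
    options≡safeOptions+cutDegree S v = trans
      (∑-cong V (λ y → trans (bit-split (choosable v y) (crosses S v y))
                             (cong (λ b → bit (choosable v y ∧ not (crosses S v y)) + bit b) (choosable-crosses S v y))))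
      (∑-+ (λ y → bit (choosable v y ∧ not (crosses S v y))) (bit ∘ crossing S v) V)

    cutDegree-isolated : ∀ S {v} → hasNeighbour G v ≡ false → cutDegree S v ≡ 0
    cutDegree-isolated S isolated = trans (countB-cong V (λ y → cong (_∧ _) (adj-isolated isolated y))) (∑-zero V)

    options≡degree : ∀ {v} → hasNeighbour G v ≡ true → options v ≡ degree v
    options≡degree {v} nb = countB-cong V (λ y → cong (λ b → if b then adj G v y else (toℕ y ≡ᵇ toℕ v)) nb)

    safeOptions≡innerDegree : ∀ S {v} → hasNeighbour G v ≡ true → safeOptions S v ≡ innerDegree S v
    safeOptions≡innerDegree S {v} nb =
      countB-cong V (λ y → cong (λ b → (if b then adj G v y else (toℕ y ≡ᵇ toℕ v)) ∧ not (crosses S v y)) nb)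

    cutDegree>0⇒hasNeighbour : ∀ S {v} → 0 < cutDegree S v → hasNeighbour G v ≡ true
    cutDegree>0⇒hasNeighbour S {v} X>0 with hasNeighbour G v in nb
    ... | true  = refl
    ... | false = contradiction (cutDegree-isolated S nb) (>⇒≢ X>0)

    -- near-min is |C(S)| ≤ (2 − 1/(k+1))λ, multiplied by k + 1.
    module _ (k : ℕ) (S : Subset n) (nonSingle : nonSingleton S ≡ true)
             (near-min : suc k * cutSize G S + edgeConnectivity G ≤ 2 * suc k * edgeConnectivity G) where

      private
        λG = edgeConnectivity G

      options-bounds : ∀ w → 0 < cutDegree S w →
        λG ≤ safeOptions S w + cutDegree S w × safeOptions S w + cutDegree S w ≤ 2 * suc k * safeOptions S w
      options-bounds w X>0 = λ≤D , ratio-bound k λG I X (cutSize G S) λ≤D λ+X≤C+I near-min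
        where
        nb = cutDegree>0⇒hasNeighbour S X>0
        I = safeOptions S w
        X = cutDegree S w
        λ≤D : λG ≤ I + X
        λ≤D = ≤-trans (edgeConnectivity≤degree w)
                      (≤-reflexive (trans (sym (options≡degree nb)) (options≡safeOptions+cutDegree S w)))
        λ+X≤C+I : λG + X ≤ cutSize G S + I
        λ+X≤C+I = begin
          λG + X                      ≤⟨ +-monoˡ-≤ X (edgeConnectivity≤cutSize G (toggle S w)
                                            (uncurry (properNonempty-toggle S w) (nonSingleton⇒≢1 S nonSingle))) ⟩
          cutSize G (toggle S w) + X  ≡⟨ cutSize-toggle S w ⟩
          cutSize G S + innerDegree S w ≡⟨ cong (cutSize G S +_) (safeOptions≡innerDegree S nb) ⟨
          cutSize G S + I             ∎
          where open ≤-Reasoning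

      ∏options≤3^[16K]*∏safeOptions : product (map options V) ≤ 3 ^ (16 * suc k) * product (map (safeOptions S) V)
      ∏options≤3^[16K]*∏safeOptions = *-cancelˡ-≤ (λG ^ s) {{pow-nonZero (8 * suc k) λG s s≤8Kλ}} (begin
        λG ^ s * ∏D               ≤⟨ ∏-pow-bound V λG (λG + 1) m options (safeOptions S) vertex ⟩
        ∏I * (λG + 1) ^ s         ≤⟨ *-monoʳ-≤ ∏I ([L+1]^s≤3^[16K]*L^s (suc k) λG s s≤8Kλ) ⟩
        ∏I * (3 ^ (16 * suc k) * λG ^ s) ≡⟨ *-CS.x∙yz≈z∙yx ∏I (3 ^ (16 * suc k)) (λG ^ s) ⟩
        λG ^ s * (3 ^ (16 * suc k) * ∏I) ∎)
        where
        open ≤-Reasoning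
        ∏D = product (map options V)
        ∏I = product (map (safeOptions S) V)
        m : Fin n → ℕ
        m w = 2 * suc k * cutDegree S w
        s = ∑ V m
        vertex : ∀ w → λG ^ m w * options w ≤ safeOptions S w * (λG + 1) ^ m w
        vertex w rewrite options≡safeOptions+cutDegree S w =
          vertex-factor-bound k λG (safeOptions S w) (cutDegree S w) (options-bounds w)
        cut≤2λ : cutSize G S ≤ 2 * λG
        cut≤2λ = *-cancelˡ-≤ (suc k) (begin
          suc k * cutSize G S           ≤⟨ m≤m+n _ λG ⟩
          suc k * cutSize G S + λG      ≤⟨ near-min ⟩
          2 * suc k * λG                ≡⟨ *-CS.xy∙z≈y∙xz 2 (suc k) λG ⟩
          suc k * (2 * λG)              ∎)
        s≤8Kλ : s ≤ 8 * suc k * λG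
        s≤8Kλ = begin
          ∑ V m                          ≡⟨ ∑-*ˡ (2 * suc k) (cutDegree S) V ⟩
          2 * suc k * ∑ V (cutDegree S)  ≡⟨ cong (2 * suc k *_) (∑-cutDegree S) ⟩
          2 * suc k * (2 * cutSize G S)  ≤⟨ *-monoʳ-≤ (2 * suc k) (*-monoʳ-≤ 2 cut≤2λ) ⟩
          2 * suc k * (2 * (2 * λG))     ≡⟨ regroup (suc k) λG ⟩
          8 * suc k * λG                 ∎
          where
          regroup : ∀ K L → 2 * K * (2 * (2 * L)) ≡ 8 * K * L
          regroup = solve-∀

    totalChoices≤3^[16K]*goodChoices : ∀ k S → nonSingleton S ≡ true →
      suc k * cutSize G S + edgeConnectivity G ≤ 2 * suc k * edgeConnectivity G →
      totalChoices G ≤ 3 ^ (16 * suc k) * goodChoices G S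
    totalChoices≤3^[16K]*goodChoices k S nonSingle near-min
      rewrite totalChoices≡∏options | goodChoices≡∏safeOptions S = ∏options≤3^[16K]*∏safeOptions k S nonSingle near-min

module Rationals where

  open import Data.Nat as ℕ using (ℕ; suc; NonZero)
  import Data.Nat.Properties as ℕ
  open import Data.Nat.Coprimality using (Coprime; 1-coprimeTo)
  import Data.Nat.Coprimality as Coprime
  open import Data.Integer as ℤ using (+_)
  import Data.Integer.Properties as ℤ
  open import Data.Integer.Tactic.RingSolver using (solve-∀)
  open import Data.Rational using (mkℚ; _/_; _≤_; _<_; _*_; _-_; toℚᵘ; -_; 0ℚ)
  open import Data.Rational.Properties
    using ( normalize-coprime; toℚᵘ-mono-≤; toℚᵘ-cancel-≤; toℚᵘ-cancel-<
          ; toℚᵘ-homo-*; toℚᵘ-homo-+; toℚᵘ-homo‿-)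
  open import Data.Rational.Unnormalised as ℚᵘ using (mkℚᵘ; *≤*; *<*)
    renaming (_≤_ to _≤ᵘ_; _*_ to _*ᵘ_; _-_ to _-ᵘ_)
  import Data.Rational.Unnormalised.Properties as ℚᵘ
  open import Relation.Binary.PropositionalEquality

  toℚᵘ-/ : ∀ {m N} → Coprime m (suc N) → toℚᵘ (+ m / suc N) ≡ mkℚᵘ (+ m) N
  toℚᵘ-/ cop = cong toℚᵘ (normalize-coprime cop)

  toℚᵘ-/1 : ∀ m → toℚᵘ (+ m / 1) ≡ mkℚᵘ (+ m) 0
  toℚᵘ-/1 m = toℚᵘ-/ (Coprime.sym (1-coprimeTo m))

  toℚᵘ-1/ : ∀ N → toℚᵘ (+ 1 / suc N) ≡ mkℚᵘ (+ 1) N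
  toℚᵘ-1/ N = toℚᵘ-/ (1-coprimeTo (suc N))

  1/-pos : ∀ M .{{_ : NonZero M}} → 0ℚ < + 1 / M
  1/-pos (suc N) = toℚᵘ-cancel-< (subst (toℚᵘ 0ℚ ℚᵘ.<_) (sym (toℚᵘ-1/ N)) (*<* (ℤ.+<+ ℕ.z<s)))

  1/-*-≤ : ∀ M .{{_ : NonZero M}} T G → T ℕ.≤ M ℕ.* G → (+ 1 / M) * (+ T / 1) ≤ + G / 1
  1/-*-≤ (suc N) T G T≤MG =
    toℚᵘ-cancel-≤ (ℚᵘ.≤-respˡ-≃ (ℚᵘ.≃-sym (toℚᵘ-homo-* (+ 1 / suc N) (+ T / 1))) unnormalised)
    where
    unit : ∀ t → + 1 ℤ.* t ℤ.* + 1 ≡ t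
    unit = solve-∀
    T≤G*[1+N*1] : T ℕ.≤ G ℕ.* suc (N ℕ.* 1)
    T≤G*[1+N*1] rewrite ℕ.*-identityʳ N = subst (T ℕ.≤_) (ℕ.*-comm (suc N) G) T≤MG
    cross : + 1 ℤ.* + T ℤ.* + 1 ℤ.≤ + G ℤ.* + suc (N ℕ.* 1)
    cross = subst₂ ℤ._≤_ (sym (unit (+ T))) (ℤ.pos-* G _) (ℤ.+≤+ T≤G*[1+N*1])
    unnormalised : toℚᵘ (+ 1 / suc N) *ᵘ toℚᵘ (+ T / 1) ≤ᵘ toℚᵘ (+ G / 1)
    unnormalised rewrite toℚᵘ-1/ N | toℚᵘ-/1 T | toℚᵘ-/1 G = *≤* cross

  near-minimum-ℤ : ∀ p d c L →
    + c ℤ.* + suc d ℤ.≤ (+ 2 ℤ.* + suc d ℤ.+ ℤ.- (+ suc p) ℤ.* + 1) ℤ.* + L ℤ.* + 1 →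
    suc d ℕ.* c ℕ.+ L ℕ.≤ 2 ℕ.* suc d ℕ.* L
  near-minimum-ℤ p d c L cD≤[2D-P]L = ℤ.drop‿+≤+ (begin
    + (suc d ℕ.* c ℕ.+ L)
      ≡⟨ trans (ℤ.pos-+ (suc d ℕ.* c) L) (cong (ℤ._+ + L) (ℤ.pos-* (suc d) c)) ⟩
    D ℤ.* C ℤ.+ + L                 ≤⟨ ℤ.+-monoʳ-≤ (D ℤ.* C) L≤PL ⟩
    D ℤ.* C ℤ.+ P ℤ.* + L           ≡⟨ cong (ℤ._+ P ℤ.* + L) (ℤ.*-comm D C) ⟩
    C ℤ.* D ℤ.+ P ℤ.* + L           ≤⟨ ℤ.+-monoˡ-≤ (P ℤ.* + L) cD≤[2D-P]L ⟩
    (+ 2 ℤ.* D ℤ.+ ℤ.- P ℤ.* + 1) ℤ.* + L ℤ.* + 1 ℤ.+ P ℤ.* + L ≡⟨ cancel D P (+ L) ⟩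
    + 2 ℤ.* D ℤ.* + L
      ≡⟨ trans (ℤ.pos-* (2 ℕ.* suc d) L) (cong (ℤ._* + L) (ℤ.pos-* 2 (suc d))) ⟨
    + (2 ℕ.* suc d ℕ.* L)           ∎)
    where
    open ℤ.≤-Reasoning
    C = + c
    D = + suc d
    P = + suc p
    L≤PL : + L ℤ.≤ P ℤ.* + L
    L≤PL = subst (+ L ℤ.≤_) (ℤ.pos-* (suc p) L) (ℤ.+≤+ (ℕ.m≤m+n L (p ℕ.* L)))
    cancel : ∀ D P L → (+ 2 ℤ.* D ℤ.+ ℤ.- P ℤ.* + 1) ℤ.* L ℤ.* + 1 ℤ.+ P ℤ.* L ≡ + 2 ℤ.* D ℤ.* L
    cancel = solve-∀

  near-minimum : ∀ p d .(cop : Coprime (suc p) (suc d)) c L →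
    + c / 1 ≤ ((+ 2 / 1) - mkℚ (+ suc p) d cop) * (+ L / 1) → suc d ℕ.* c ℕ.+ L ℕ.≤ 2 ℕ.* suc d ℕ.* L
  near-minimum p d cop c L c≤[2-ε]L = near-minimum-ℤ p d c L
    (subst (λ x → + c ℤ.* + suc x ℤ.≤ [2D-P]L) (trans (ℕ.*-identityʳ (d ℕ.+ 0)) (ℕ.+-identityʳ d))
           (ℚᵘ.drop-*≤* unnormalised))
    where
    ε = mkℚ (+ suc p) d cop
    [2D-P]L = (+ 2 ℤ.* + suc d ℤ.+ ℤ.- (+ suc p) ℤ.* + 1) ℤ.* + L ℤ.* + 1
    homo : toℚᵘ ((+ 2 / 1 - ε) * (+ L / 1)) ℚᵘ.≃ (toℚᵘ (+ 2 / 1) -ᵘ toℚᵘ ε) *ᵘ toℚᵘ (+ L / 1)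
    homo = ℚᵘ.≃-trans (toℚᵘ-homo-* (+ 2 / 1 - ε) (+ L / 1)) (ℚᵘ.*-congʳ
             (ℚᵘ.≃-trans (toℚᵘ-homo-+ (+ 2 / 1) (- ε)) (ℚᵘ.+-congʳ (toℚᵘ (+ 2 / 1)) (toℚᵘ-homo‿- ε))))
    unnormalised : mkℚᵘ (+ c) 0 ≤ᵘ (mkℚᵘ (+ 2) 0 -ᵘ mkℚᵘ (+ suc p) d) *ᵘ mkℚᵘ (+ L) 0
    unnormalised = subst₂ _≤ᵘ_
      (toℚᵘ-/1 c) (cong₂ (λ a b → (a -ᵘ mkℚᵘ (+ suc p) d) *ᵘ b) (toℚᵘ-/1 2) (toℚᵘ-/1 L))
      (ℚᵘ.≤-respʳ-≃ homo (toℚᵘ-mono-≤ c≤[2-ε]L))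

open import Defs
open import Data.Bool using (true)
open import Data.Nat using (ℕ)
open import Data.Integer using (+_)
open import Data.Rational using (ℚ; _/_; _≤_; _<_; _*_; _-_; 0ℚ; 1ℚ)
open import Data.Fin.Subset using (Subset)
open import Data.Product using (Σ; _×_)
open import Relation.Binary.PropositionalEquality using (_≡_)

open import Data.Integer using (-[1+_])
open import Data.Integer.Base using (+<+)
import Data.Nat as ℕ
open import Data.Nat.Properties using (m^n≢0)
open import Data.Product using (_,_)
open import Data.Rational using (mkℚ; *<*)
open Cuts using (totalChoices≤3^[16K]*goodChoices)
open Rationals using (1/-pos; 1/-*-≤; near-minimum)

lemma2p7 : (ε : ℚ) → 0ℚ < ε → ε ≤ 1ℚ →
    Σ ℚ (λ q → (0ℚ < q) ×
      ((n : ℕ) (G : SimpleGraph n) (S : Subset n) →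
        nonSingleton S ≡ true →
        (+ cutSize G S / 1) ≤ ((+ 2 / 1) - ε) * (+ edgeConnectivity G / 1) →
        q * (+ totalChoices G / 1) ≤ (+ goodChoices G S / 1)))
-- ε = (p + 1)/(d + 1) ≥ 1/(d + 1), so K = d + 1 works.
lemma2p7 (mkℚ (+ 0)       _ _)   (*<* (+<+ ())) _
lemma2p7 (mkℚ -[1+ _ ]    _ _)   (*<* ())       _
lemma2p7 (mkℚ (+ ℕ.suc p) d cop) _              _ =
  + 1 / M , 1/-pos M , λ n G S nonSingle cut≤[2-ε]λ →
    1/-*-≤ M (totalChoices G) (goodChoices G S) (totalChoices≤3^[16K]*goodChoices G d S nonSingle
      (near-minimum p d cop (cutSize G S) (edgeConnectivity G) cut≤[2-ε]λ))
  where
  M = 3 ℕ.^ (16 ℕ.* ℕ.suc d)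
  instance
    M≢0 = m^n≢0 3 (16 ℕ.* ℕ.suc d)
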